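{- Let $b\ge 2$ be an integer and let $k,r,y$ be nonnegative integers with $2y<r<k-1$. Let $a_ka_{k-1}\cdots a_0$ be the ordinary base $b$ expansion of $\nu(k,r,y)-1$, and write $\nu(k,r,y)-1=b^{e_0}+b^{e_1}+\cdots+b^{e_\ell}$ with nonnegative integers $e_0<e_1<\cdots<e_\ell=k$. Let $\lambda$ be the smallest nonnegative integer such that $e_{\ell-1-\lambda}\leq r-2\lambda-1$. Then there is no $i\in\{1,2,\ldots,e_{\ell-1-\lambda}\}$ with $a_i=a_{i+1}$.
   Context: Fix an integer $b\ge 2$. A base $b$ over-expansion of a positive integer $N$ is a word $d_kd_{k-1}\cdots d_0$ over $\{0,1,\ldots,b\}$ with $d_k\neq 0$ and $\sum_{i=0}^k d_ib^i=N$; the ordinary base $b$ expansion is the unique one using only digits $0,\dots,b-1$. For $n\ge 2$, $s_b(n)$ is the number of base $b$ over-expansions of $n-1$; $s_b(0)=0$, $s_b(1)=1$. For nonnegative integers $k,r,y$: $I(k,r,y)=\{n\in\mathbb N: b^k<n\le b^k+\sum_{i=0}^y b^{r-2i}\}$, $\mu(k,r,y)=\max\{s_b(n):n\in I(k,r,y)\}$, and $\nu(k,r,y)=\min\{n\in I(k,r,y): s_b(n)=\mu(k,r,y)\}$. (The ordinary base $b$ expansion of $\nu(k,r,y)-1$ has $k+1$ digits, all in $\{0,1\}$.) -}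

module Defs where

open import Data.Nat using (ℕ; zero; suc; _+_; _*_; _∸_; _^_; _≡ᵇ_; _⊔_; _/_; _%_)
open import Data.Nat.Properties using (m^n≢0)
open import Data.Bool using (Bool; true; false; not; _∧_; if_then_else_)
open import Data.List using (List; []; _∷_; length; map; filter; concatMap; upTo; foldr)
open import Data.Nat.ListAction using (sum)
open import Relation.Nullary.Decidable using (Dec; yes; no)
open import Data.Bool.Properties using (T?)

-- A word is a list of digits, LEAST significant digit first: d₀ ∷ d₁ ∷ … ∷ d_k.
-- Value of a word in base b: Σ dᵢ bⁱ.
value : ℕ → List ℕ → ℕ
value b []       = 0
value b (d ∷ ds) = d + b * value b ds

leadNonzero : List ℕ → Bool
leadNonzero []           = false
leadNonzero (d ∷ [])     = not (d ≡ᵇ 0)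
leadNonzero (d ∷ e ∷ ds) = leadNonzero (e ∷ ds)

allWords : ℕ → ℕ → List (List ℕ)
allWords b zero    = [] ∷ []
allWords b (suc L) = concatMap (λ d → map (d ∷_) (allWords b L)) (upTo (suc b))

isOverExp : ℕ → ℕ → List ℕ → Bool
isOverExp b N w = leadNonzero w ∧ (value b w ≡ᵇ N)

-- An over-expansion d_k…d₀ of N ≥ 1
-- satisfies b^k ≤ N, hence has length k+1 ≤ N+1; so enumerating all words of
-- lengths 1,…,N+1 over {0,…,b} finds all of them (each exactly once).
overCount : ℕ → ℕ → ℕ
overCount b N =
  length (filter (λ w → T? (isOverExp b N w))
                 (concatMap (allWords b) (map suc (upTo (suc N)))))

s : ℕ → ℕ → ℕ
s b zero          = 0
s b (suc zero)    = 1
s b (suc (suc m)) = overCount b (suc m)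

-- Σ_{i=0}^{y} b^{r-2i}  (used only when 2y < r, so r ∸ 2i is honest subtraction)
geomSum : ℕ → ℕ → ℕ → ℕ
geomSum b r y = sum (map (λ i → b ^ (r ∸ 2 * i)) (upTo (suc y)))

intervalList : ℕ → ℕ → ℕ → ℕ → List ℕ
intervalList b k r y = map (λ j → b ^ k + suc j) (upTo (geomSum b r y))

μ : ℕ → ℕ → ℕ → ℕ → ℕ
μ b k r y = foldr (λ n m → s b n ⊔ m) 0 (intervalList b k r y)

firstWith : ℕ → ℕ → List ℕ → ℕ
firstWith b m []       = 0
firstWith b m (n ∷ ns) = if s b n ≡ᵇ m then n else firstWith b m ns

-- ν(k,r,y) = min { n ∈ I(k,r,y) : s_b(n) = μ(k,r,y) }  (the list is increasing)
ν : ℕ → ℕ → ℕ → ℕ → ℕ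
ν b k r y = firstWith b (μ b k r y) (intervalList b k r y)

-- i-th digit of the ordinary base-b expansion of N (b ≥ 1; b = 0 is a dummy case).
digit : ℕ → ℕ → ℕ → ℕ
digit zero    N i = 0
digit (suc c) N i = (_/_ N (suc c ^ i) {{m^n≢0 (suc c) i}}) % suc c

-- Exponents e₀ < e₁ < … < e_ℓ: positions of the nonzero digits of N,
-- in increasing order (positions ≥ N+1 carry digit 0 since b^i > N there).
exps : ℕ → ℕ → List ℕ
exps b N = filter (λ i → T? (not (digit b N i ≡ᵇ 0))) (upTo (suc N))

nth : List ℕ → ℕ → ℕ
nth []       j       = 0
nth (x ∷ xs) zero    = x
nth (x ∷ xs) (suc j) = nth xs j

-- Splitting an over-expansion of N = j + b m (j < b) at its last digit, which is j or, when j = 0, b, gives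
-- s(bm + 1) = s(m + 1) + s(m) and s(bm + j + 1) = s(m + 1) for 0 < j < b. Hence (s(N + 1), s(N)) is computed
-- by reading the digits of N from the top, starting from (1, 0), with the moves
--   0 : (x, y) ↦ (x + y, y),   1 : (x, y) ↦ (x, x + y),   d ≥ 2 : (x, y) ↦ (x, x).
-- After n digits the first entry is at most F(n+1) a + F(n) a′ when both entries are at most a and one of them
-- at most a′, and the digits 1, 0, 1, 0, … reach F(n+1) x + F(n) y. So the first maximiser over n digits starts
-- with 0 from a state x ≤ y and with 1 from a state y < x; these two moves lead from each kind of state to the
-- other, so its digits alternate 0, 1, 0, 1, … down to position 1.
-- Write ν − 1 = b^k + j with j < b^r + b^(r−2) + ⋯ + b^(r−2y). The minimality of λ forces the digits of j above
-- E = e_{ℓ−1−λ} to be those of b^r + b^(r−2) + ⋯ + b^(r−2λ+2). So j has digit 0 at E + 1, every change of its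
-- digits below E + 1 stays in the interval, and j is the first maximiser among these changes of one run of the
-- moves from a state y < x; its digits from E + 1 down to 1 therefore alternate.

module Submission where

open import Defs
open import Data.Bool using (Bool; true; false; not; _∧_; if_then_else_; T)
open import Data.Bool.Properties using (T?; T-≡; ∧-zeroʳ)
open import Data.Empty using (⊥-elim)
open import Data.List using (List; []; _∷_; _++_; length; map; filter; concatMap; upTo; applyUpTo; foldr)
open import Data.List.Properties using (map-upTo; map-∘; map-cong; map-++; map-id; ++-assoc; length-++; filter-≐)
open import Data.List.Relation.Unary.All as All using (All; []; _∷_)
open import Data.List.Relation.Unary.All.Properties using (concat⁺; map⁺)
open import Data.Nat
open import Data.Nat.DivMod
open import Data.Nat.ListAction using (sum)
open import Data.Nat.Properties
open import Data.Nat.Tactic.RingSolver using (solve-∀)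
open import Data.Product using (∃-syntax; _×_; _,_; proj₁; proj₂)
open import Data.Sum using (_⊎_; inj₁; inj₂; [_,_])
open import Function using (_∘_; id; Equivalence)
open import Relation.Binary.Definitions using (Tri; tri<; tri≈; tri>)
open import Relation.Binary.PropositionalEquality
  using (_≡_; _≢_; refl; sym; trans; cong; cong₂; subst; subst₂; module ≡-Reasoning)
open import Relation.Nullary using (¬_; yes; no)

count : {A : Set} → (A → Bool) → List A → ℕ
count p []       = 0
count p (x ∷ xs) = (if p x then 1 else 0) + count p xs

length-filter≡count : {A : Set} (p : A → Bool) (xs : List A) →
  length (filter (T? ∘ p) xs) ≡ count p xs
length-filter≡count p [] = refl
length-filter≡count p (x ∷ xs) with p x
... | true  = cong suc (length-filter≡count p xs)
... | false = length-filter≡count p xs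

count-++ : {A : Set} (p : A → Bool) (xs ys : List A) → count p (xs ++ ys) ≡ count p xs + count p ys
count-++ p []       ys = refl
count-++ p (x ∷ xs) ys =
  trans (cong ((if p x then 1 else 0) +_) (count-++ p xs ys)) (sym (+-assoc (if p x then 1 else 0) _ _))

count-concatMap : {A B : Set} (p : B → Bool) (f : A → List B) (xs : List A) →
  count p (concatMap f xs) ≡ sum (map (count p ∘ f) xs)
count-concatMap p f []       = refl
count-concatMap p f (x ∷ xs) = trans (count-++ p (f x) (concatMap f xs)) (cong (count p (f x) +_) (count-concatMap p f xs))

count-map : {A B : Set} (p : B → Bool) (f : A → B) (xs : List A) → count p (map f xs) ≡ count (p ∘ f) xs
count-map p f []       = refl
count-map p f (x ∷ xs) = cong ((if p (f x) then 1 else 0) +_) (count-map p f xs)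

count-congᴬ : {A : Set} {p q : A → Bool} (xs : List A) → All (λ x → p x ≡ q x) xs → count p xs ≡ count q xs
count-congᴬ []       []       = refl
count-congᴬ (x ∷ xs) (e ∷ es) = cong₂ _+_ (cong (λ z → if z then 1 else 0) e) (count-congᴬ xs es)

count-cong : {A : Set} {p q : A → Bool} (xs : List A) → (∀ x → p x ≡ q x) → count p xs ≡ count q xs
count-cong xs e = count-congᴬ xs (All.universal e xs)

count-none : {A : Set} (p : A → Bool) (xs : List A) → (∀ x → p x ≡ false) → count p xs ≡ 0
count-none p []       e = refl
count-none p (x ∷ xs) e rewrite e x = count-none p xs e

filterᵇ : (ℕ → Bool) → List ℕ → List ℕ
filterᵇ p = filter (T? ∘ p)

filterᵇ-∷ : ∀ p x xs → filterᵇ p (x ∷ xs) ≡ (if p x then x ∷ [] else []) ++ filterᵇ p xs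
filterᵇ-∷ p x xs with p x
... | true  = refl
... | false = refl

filterᵇ-map : ∀ p (f : ℕ → ℕ) xs → filterᵇ p (map f xs) ≡ map f (filterᵇ (p ∘ f) xs)
filterᵇ-map p f []       = refl
filterᵇ-map p f (x ∷ xs) with p (f x)
... | true  = cong (f x ∷_) (filterᵇ-map p f xs)
... | false = filterᵇ-map p f xs

filterᵇ-cong : ∀ {p q} xs → (∀ i → p i ≡ q i) → filterᵇ p xs ≡ filterᵇ q xs
filterᵇ-cong {p} {q} xs p≗q = filter-≐ (T? ∘ p) (T? ∘ q) ((λ {i} → subst T (p≗q i)) , (λ {i} → subst T (sym (p≗q i)))) xs

filterᵇ-pad : ∀ p f m d → (∀ i → m ≤ i → p (f i) ≡ false) → filterᵇ p (applyUpTo f (m + d)) ≡ filterᵇ p (applyUpTo f m)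
filterᵇ-pad p f zero    zero    none = refl
filterᵇ-pad p f zero    (suc d) none = trans (filterᵇ-∷ p (f 0) _)
  (trans (cong (λ u → (if u then f 0 ∷ [] else []) ++ filterᵇ p (applyUpTo (f ∘ suc) d)) (none 0 z≤n))
         (filterᵇ-pad p (f ∘ suc) zero d (λ i _ → none (suc i) z≤n)))
filterᵇ-pad p f (suc m) d    none = trans (filterᵇ-∷ p (f 0) _)
  (trans (cong ((if p (f 0) then f 0 ∷ [] else []) ++_) (filterᵇ-pad p (f ∘ suc) m d (λ i m≤i → none (suc i) (s≤s m≤i))))
         (sym (filterᵇ-∷ p (f 0) _)))

fromTop : List ℕ → ℕ → ℕ
fromTop xs t = nth xs (length xs ∸ 1 ∸ t)

nth-++ˡ : ∀ xs ys {i} → i < length xs → nth (xs ++ ys) i ≡ nth xs i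
nth-++ˡ (x ∷ xs) ys {zero}  _         = refl
nth-++ˡ (x ∷ xs) ys {suc i} (s<s i<n) = nth-++ˡ xs ys i<n

length-snoc : ∀ (xs : List ℕ) p → length (xs ++ p ∷ []) ≡ suc (length xs)
length-snoc xs p = trans (length-++ xs) (+-comm (length xs) 1)

fromTop-snoc-zero : ∀ xs p → fromTop (xs ++ p ∷ []) 0 ≡ p
fromTop-snoc-zero xs p = trans (cong (λ n → nth (xs ++ p ∷ []) (n ∸ 1 ∸ 0)) (length-snoc xs p)) (last xs)
  where
  last : ∀ xs → nth (xs ++ p ∷ []) (length xs) ≡ p
  last []       = refl
  last (x ∷ xs) = last xs

fromTop-snoc-suc : ∀ xs p {t} → t < length xs → fromTop (xs ++ p ∷ []) (suc t) ≡ fromTop xs t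
fromTop-snoc-suc xs p {t} t<n = begin
  nth (xs ++ p ∷ []) (length (xs ++ p ∷ []) ∸ 1 ∸ suc t)   ≡⟨ cong (λ n → nth (xs ++ p ∷ []) (n ∸ 1 ∸ suc t)) (length-snoc xs p) ⟩
  nth (xs ++ p ∷ []) (length xs ∸ suc t)                   ≡⟨ nth-++ˡ xs (p ∷ []) (∸-<  t<n) ⟩
  nth xs (length xs ∸ suc t)                               ≡⟨ cong (nth xs) (∸-+-assoc (length xs) 1 t) ⟨
  fromTop xs t                                             ∎
  where
  open ≡-Reasoning
  ∸-< : ∀ {n} → t < n → n ∸ suc t < n
  ∸-< {suc n} _ = s≤s (m∸n≤m n t)

fromTop-below-last : ∀ xs p {t} → t < length xs → nth (xs ++ p ∷ []) (length (xs ++ p ∷ []) ∸ 1 ∸ 1 ∸ t) ≡ fromTop xs t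
fromTop-below-last xs p {t} t<ℓ =
  trans (cong (nth (xs ++ p ∷ [])) (∸-+-assoc (length (xs ++ p ∷ []) ∸ 1) 1 t)) (fromTop-snoc-suc xs p t<ℓ)

sumUpTo : (ℕ → ℕ) → ℕ → ℕ
sumUpTo f n = sum (applyUpTo f n)

sumUpTo-cong : ∀ {f g} n → (∀ i → i < n → f i ≡ g i) → sumUpTo f n ≡ sumUpTo g n
sumUpTo-cong zero    e = refl
sumUpTo-cong (suc n) e = cong₂ _+_ (e 0 z<s) (sumUpTo-cong n (λ i i<n → e (suc i) (s<s i<n)))

sumUpTo-distrib-+ : ∀ f g n → sumUpTo (λ i → f i + g i) n ≡ sumUpTo f n + sumUpTo g n
sumUpTo-distrib-+ f g zero    = refl
sumUpTo-distrib-+ f g (suc n) = begin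
  f 0 + g 0 + sumUpTo (λ i → f (suc i) + g (suc i)) n
    ≡⟨ cong (f 0 + g 0 +_) (sumUpTo-distrib-+ (f ∘ suc) (g ∘ suc) n) ⟩
  f 0 + g 0 + (sumUpTo (f ∘ suc) n + sumUpTo (g ∘ suc) n)
    ≡⟨ +-medial (f 0) (g 0) _ _ ⟩
  f 0 + sumUpTo (f ∘ suc) n + (g 0 + sumUpTo (g ∘ suc) n) ∎
  where
  open ≡-Reasoning
  +-medial : ∀ a b c d → a + b + (c + d) ≡ a + c + (b + d)
  +-medial = solve-∀

sumUpTo-zero : ∀ {f} n → (∀ i → i < n → f i ≡ 0) → sumUpTo f n ≡ 0
sumUpTo-zero n e = trans (sumUpTo-cong n e) (zeros n)
  where
  zeros : ∀ n → sumUpTo (λ _ → 0) n ≡ 0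
  zeros zero    = refl
  zeros (suc n) = zeros n

sumUpTo-delta : ∀ {j} X n → j < n → sumUpTo (λ i → if i ≡ᵇ j then X else 0) n ≡ X
sumUpTo-delta {zero}  X (suc n) _ = trans (cong (X +_) (sumUpTo-zero n (λ _ _ → refl))) (+-identityʳ X)
sumUpTo-delta {suc j} X (suc n) (s<s j<n) = sumUpTo-delta X n j<n

sumUpTo-pad : ∀ {f} m d → (∀ i → m ≤ i → f i ≡ 0) → sumUpTo f (m + d) ≡ sumUpTo f m
sumUpTo-pad         zero    d e = sumUpTo-zero d (λ i _ → e i z≤n)
sumUpTo-pad {f = f} (suc m) d e = cong (f 0 +_) (sumUpTo-pad m d (λ i m≤i → e (suc i) (s≤s m≤i)))

sumUpTo-support : ∀ {f} m n → (∀ i → m ≤ i → f i ≡ 0) → (∀ i → n ≤ i → f i ≡ 0) → sumUpTo f m ≡ sumUpTo f n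
sumUpTo-support m n em en with ≤-total m n
... | inj₁ m≤n = trans (sym (sumUpTo-pad m (n ∸ m) em)) (cong (sumUpTo _) (m+[n∸m]≡n m≤n))
... | inj₂ n≤m = trans (cong (sumUpTo _) (sym (m+[n∸m]≡n n≤m))) (sumUpTo-pad n (m ∸ n) en)

≡ᵇ-true : ∀ {m n} → m ≡ n → (m ≡ᵇ n) ≡ true
≡ᵇ-true {m} {n} e = Equivalence.to T-≡ (≡⇒≡ᵇ m n e)

≡ᵇ-false : ∀ {m n} → m ≢ n → (m ≡ᵇ n) ≡ false
≡ᵇ-false {m} {n} m≢n with m ≡ᵇ n in eq
... | false = refl
... | true  = ⊥-elim (m≢n (≡ᵇ⇒≡ m n (subst T (sym eq) _)))

≡ᵇ-cong : ∀ {m n u v} → (m ≡ n → u ≡ v) → (u ≡ v → m ≡ n) → (m ≡ᵇ n) ≡ (u ≡ᵇ v)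
≡ᵇ-cong {m} {n} to from with m ≟ n
... | yes e = trans (≡ᵇ-true e) (sym (≡ᵇ-true (to e)))
... | no ne = trans (≡ᵇ-false ne) (sym (≡ᵇ-false (ne ∘ from)))

+-*-strictMonoʳ : ∀ {q j₁ m₁ j₂ m₂} → j₁ < q → m₁ < m₂ → j₁ + q * m₁ < j₂ + q * m₂
+-*-strictMonoʳ {q} {j₁} {m₁} {j₂} {m₂} j₁<q m₁<m₂ = begin-strict
  j₁ + q * m₁   <⟨ +-monoˡ-< (q * m₁) j₁<q ⟩
  q + q * m₁    ≡⟨ *-suc q m₁ ⟨
  q * suc m₁    ≤⟨ *-monoʳ-≤ q m₁<m₂ ⟩
  q * m₂        ≤⟨ m≤n+m (q * m₂) j₂ ⟩
  j₂ + q * m₂   ∎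
  where open ≤-Reasoning

*-+-< : ∀ {p q r m} → p < q → r < m → p * m + r < q * m
*-+-< {p} {q} {r} {m} p<q r<m = begin-strict
  p * m + r   <⟨ +-monoʳ-< (p * m) r<m ⟩
  p * m + m   ≡⟨ +-comm (p * m) m ⟩
  suc p * m   ≤⟨ *-monoˡ-≤ m p<q ⟩
  q * m       ∎
  where open ≤-Reasoning

divMod-unique : ∀ {q j₁ m₁ j₂ m₂} → j₁ < q → j₂ < q → j₁ + q * m₁ ≡ j₂ + q * m₂ → j₁ ≡ j₂ × m₁ ≡ m₂
divMod-unique {q} {j₁} {m₁} {j₂} {m₂} j₁<q j₂<q eq with <-cmp m₁ m₂
... | tri< m₁<m₂ _ _ = ⊥-elim (<-irrefl eq (+-*-strictMonoʳ j₁<q m₁<m₂))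
... | tri≈ _ refl _ = +-cancelʳ-≡ (q * m₁) j₁ j₂ eq , refl
... | tri> _ _ m₂<m₁ = ⊥-elim (<-irrefl (sym eq) (+-*-strictMonoʳ j₂<q m₂<m₁))

m≡m%n+n*[m/n] : ∀ m n .{{_ : NonZero n}} → m ≡ m % n + n * (m / n)
m≡m%n+n*[m/n] m n = trans (m≡m%n+[m/n]*n m n) (cong (m % n +_) (*-comm (m / n) n))

%-/-unique : ∀ {m n j q} .{{_ : NonZero n}} → j < n → m ≡ j + n * q → m % n ≡ j × m / n ≡ q
%-/-unique {m} {n} j<n eq = divMod-unique (m%n<n m n) j<n (trans (sym (m≡m%n+n*[m/n] m n)) eq)

fib : ℕ → ℕ
fib zero          = 0
fib (suc zero)    = 1
fib (suc (suc n)) = fib (suc n) + fib n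

fib-suc-positive : ∀ n → 1 ≤ fib (suc n)
fib-suc-positive zero    = s≤s z≤n
fib-suc-positive (suc n) = ≤-trans (fib-suc-positive n) (m≤m+n (fib (suc n)) (fib n))

module Radix (c : ℕ) where

  b : ℕ
  b = suc (suc c)

  x+x≤b*x : ∀ x → x + x ≤ b * x
  x+x≤b*x x = +-monoʳ-≤ x (m≤m+n x (c * x))

  n<b^n : ∀ n → n < b ^ n
  n<b^n zero    = z<s
  n<b^n (suc n) = begin-strict
    suc n           <⟨ s<s (n<b^n n) ⟩
    suc (b ^ n)     ≤⟨ +-monoˡ-≤ (b ^ n) (m^n>0 b n) ⟩
    b ^ n + b ^ n   ≤⟨ x+x≤b*x (b ^ n) ⟩
    b ^ suc n       ∎
    where open ≤-Reasoning

  /b-< : ∀ {N} n → N < b ^ suc n → N / b < b ^ n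
  /b-< {N} n lt = m<n*o⇒m/o<n (subst (N <_) (*-comm b (b ^ n)) lt)

  lead-+-< : ∀ {d L} n → d < b → L < b ^ n → d * b ^ n + L < b ^ suc n
  lead-+-< n = *-+-<

  split-leading : ∀ n R → R < b ^ suc n → ∃[ d ] ∃[ L ] (d < b × L < b ^ n × R ≡ d * b ^ n + L)
  split-leading n R lt =
    R / bⁿ , R % bⁿ , m<n*o⇒m/o<n lt , m%n<n R bⁿ ,
    trans (m≡m%n+[m/n]*n R bⁿ) (+-comm (R % bⁿ) (R / bⁿ * bⁿ))
    where
    bⁿ = b ^ n
    instance _ = m^n≢0 b n

  shift-%-/ : ∀ P m R → (P * b ^ suc m + R) % b ≡ R % b × (P * b ^ suc m + R) / b ≡ P * b ^ m + R / b
  shift-%-/ P m R = %-/-unique (m%n<n R b)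
    (trans (cong (P * b ^ suc m +_) (m≡m%n+n*[m/n] R b)) (ring P b (b ^ m) (R % b) (R / b)))
    where
    ring : ∀ d b p r q → d * (b * p) + (r + b * q) ≡ r + b * (d * p + q)
    ring = solve-∀

  shift-% : ∀ P m R → (P * b ^ suc m + R) % b ≡ R % b
  shift-% P m R = proj₁ (shift-%-/ P m R)

  shift-/ : ∀ P m R → (P * b ^ suc m + R) / b ≡ P * b ^ m + R / b
  shift-/ P m R = proj₂ (shift-%-/ P m R)

  digit-zero : ∀ N → digit b N 0 ≡ N % b
  digit-zero N = cong (_% b) (n/1≡n N)

  digit-suc : ∀ N i → digit b N (suc i) ≡ digit b (N / b) i
  digit-suc N i = cong (_% b) (sym (m/n/o≡m/[n*o] N b (b ^ i) {{_}} {{m^n≢0 b i}} {{m^n≢0 b (suc i)}}))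

  digit-small : ∀ {N} i → N < b ^ i → digit b N i ≡ 0
  digit-small i lt = cong (_% b) (m<n⇒m/n≡0 {{m^n≢0 b i}} lt)

  digit-low : ∀ {i n} Y L → i < n → digit b (Y * b ^ n + L) i ≡ digit b L i
  digit-low {zero} {suc n} Y L _ =
    trans (digit-zero (Y * b ^ suc n + L)) (trans (shift-% Y n L) (sym (digit-zero L)))
  digit-low {suc i} {suc n} Y L (s<s i<n) = begin
    digit b (Y * b ^ suc n + L) (suc i)   ≡⟨ digit-suc _ i ⟩
    digit b ((Y * b ^ suc n + L) / b) i   ≡⟨ cong (λ z → digit b z i) (shift-/ Y n L) ⟩
    digit b (Y * b ^ n + L / b) i         ≡⟨ digit-low Y (L / b) i<n ⟩
    digit b (L / b) i                     ≡⟨ digit-suc L i ⟨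
    digit b L (suc i)                     ∎
    where open ≡-Reasoning

  digit-lead : ∀ {d L} n → d < b → L < b ^ n → digit b (d * b ^ n + L) n ≡ d
  digit-lead {d} {zero} zero d<b _ = begin
    digit b (d * 1 + 0) 0   ≡⟨ digit-zero (d * 1 + 0) ⟩
    (d * 1 + 0) % b         ≡⟨ cong (_% b) (trans (+-identityʳ (d * 1)) (*-identityʳ d)) ⟩
    d % b                   ≡⟨ m<n⇒m%n≡m d<b ⟩
    d                       ∎
    where open ≡-Reasoning
  digit-lead {L = suc L} zero _ (s<s ())
  digit-lead {d} {L} (suc n) d<b L<bⁿ = begin
    digit b (d * b ^ suc n + L) (suc n)   ≡⟨ digit-suc _ n ⟩
    digit b ((d * b ^ suc n + L) / b) n   ≡⟨ cong (λ z → digit b z n) (shift-/ d n L) ⟩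
    digit b (d * b ^ n + L / b) n         ≡⟨ digit-lead n d<b (/b-< n L<bⁿ) ⟩
    d                                     ∎
    where open ≡-Reasoning

  overCountLen : ℕ → ℕ → ℕ
  overCountLen L N = count (isOverExp b N) (allWords b L)

  overCountLowest : ℕ → ℕ → ℕ → ℕ
  overCountLowest L N d = count (λ w → isOverExp b N (d ∷ w)) (allWords b L)

  overCount≡sumUpTo : ∀ N → overCount b N ≡ sumUpTo (λ L → overCountLen (suc L) N) (suc N)
  overCount≡sumUpTo N = begin
    overCount b N
      ≡⟨ length-filter≡count (isOverExp b N) words ⟩
    count (isOverExp b N) words
      ≡⟨ count-concatMap (isOverExp b N) (allWords b) (map suc (upTo (suc N))) ⟩
    sum (map (λ L → overCountLen L N) (map suc (upTo (suc N))))
      ≡⟨ cong sum (map-∘ (upTo (suc N))) ⟨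
    sum (map (λ L → overCountLen (suc L) N) (upTo (suc N)))
      ≡⟨ cong sum (map-upTo (λ L → overCountLen (suc L) N) (suc N)) ⟩
    sumUpTo (λ L → overCountLen (suc L) N) (suc N) ∎
    where
    open ≡-Reasoning
    words = concatMap (allWords b) (map suc (upTo (suc N)))

  overCountLen-suc : ∀ L N → overCountLen (suc L) N ≡ sumUpTo (overCountLowest L N) (suc b)
  overCountLen-suc L N = begin
    count (isOverExp b N) (concatMap (λ d → map (d ∷_) (allWords b L)) (upTo (suc b)))
      ≡⟨ count-concatMap (isOverExp b N) (λ d → map (d ∷_) (allWords b L)) (upTo (suc b)) ⟩
    sum (map (λ d → count (isOverExp b N) (map (d ∷_) (allWords b L))) (upTo (suc b)))
      ≡⟨ cong sum (map-cong (λ d → count-map (isOverExp b N) (d ∷_) (allWords b L)) (upTo (suc b))) ⟩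
    sum (map (overCountLowest L N) (upTo (suc b)))
      ≡⟨ cong sum (map-upTo (overCountLowest L N) (suc b)) ⟩
    sumUpTo (overCountLowest L N) (suc b) ∎
    where open ≡-Reasoning

  overCountLowest-single : ∀ N d → overCountLowest 0 N d ≡ (if d ≡ᵇ N then (if N ≡ᵇ 0 then 0 else 1) else 0)
  overCountLowest-single N d rewrite *-zeroʳ b | +-identityʳ d with d ≟ N
  ... | yes refl rewrite ≡ᵇ-true {d} {d} refl with d
  ...   | zero  = refl
  ...   | suc _ = refl
  overCountLowest-single N d | no d≢N rewrite ≡ᵇ-false d≢N | ∧-zeroʳ (not (d ≡ᵇ 0)) = refl

  overCountLen-one : ∀ N → overCountLen 1 N ≡ sumUpTo (λ d → if d ≡ᵇ N then (if N ≡ᵇ 0 then 0 else 1) else 0) (suc b)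
  overCountLen-one N = trans (overCountLen-suc 0 N) (sumUpTo-cong (suc b) (λ d _ → overCountLowest-single N d))

  overCountLen-one-zero : overCountLen 1 0 ≡ 0
  overCountLen-one-zero = trans (overCountLen-one 0) (sumUpTo-delta 0 (suc b) z<s)

  overCountLen-one-digit : ∀ {N} → 1 ≤ N → N ≤ b → overCountLen 1 N ≡ 1
  overCountLen-one-digit {suc n} _ N≤b = trans (overCountLen-one (suc n)) (sumUpTo-delta 1 (suc b) (s≤s N≤b))

  overCountLen-one-large : ∀ {N} → b < N → overCountLen 1 N ≡ 0
  overCountLen-one-large {N} b<N = trans (overCountLen-one N) (sumUpTo-zero (suc b) (λ d d≤b →
    cong (λ z → if z then (if N ≡ᵇ 0 then 0 else 1) else 0) (≡ᵇ-false (λ d≡N → <-irrefl d≡N (≤-<-trans (≤-pred d≤b) b<N)))))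

  allWords-suc-lead : ∀ L → All (λ w → ∀ e → leadNonzero (e ∷ w) ≡ leadNonzero w) (allWords b (suc L))
  allWords-suc-lead L =
    concat⁺ (map⁺ (All.universal (λ d → map⁺ (All.universal (λ w e → refl) (allWords b L))) (upTo (suc b))))

  overCountLowest-lead : ∀ L N d →
    overCountLowest (suc L) N d ≡ count (λ w → leadNonzero w ∧ (d + b * value b w ≡ᵇ N)) (allWords b (suc L))
  overCountLowest-lead L N d =
    count-congᴬ (allWords b (suc L)) (All.map (λ {w} lead → cong (_∧ (d + b * value b w ≡ᵇ N)) (lead d)) (allWords-suc-lead L))

  overCountLowest-unique : ∀ L N d m → (∀ v → d + b * v ≡ N → v ≡ m) → (∀ v → v ≡ m → d + b * v ≡ N) →
    overCountLowest (suc L) N d ≡ overCountLen (suc L) m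
  overCountLowest-unique L N d m to from = trans (overCountLowest-lead L N d)
    (count-cong (allWords b (suc L)) (λ w → cong (leadNonzero w ∧_) (≡ᵇ-cong (to (value b w)) (from (value b w)))))

  overCountLowest-none : ∀ L N d → (∀ v → d + b * v ≢ N) → overCountLowest (suc L) N d ≡ 0
  overCountLowest-none L N d none = trans (overCountLowest-lead L N d) (count-none _ (allWords b (suc L))
    (λ w → trans (cong (leadNonzero w ∧_) (≡ᵇ-false (none (value b w)))) (∧-zeroʳ (leadNonzero w))))

  -- Over-expansions of j + b m ending in the digit b are those of m − 1 followed by b; they need j = 0.
  carry : ℕ → ℕ → ℕ → ℕ
  carry L zero (suc m) = overCountLen (suc L) m
  carry L _    _       = 0

  overCountLowest-b : ∀ L j m → j < b → overCountLowest (suc L) (j + b * m) b ≡ carry L j m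
  overCountLowest-b L zero zero _ = overCountLowest-none L (0 + b * 0) b
    (λ v e → 0≢1+n (sym (proj₂ (divMod-unique {b} {0} {suc v} z<s z<s (trans (*-suc b v) e)))))
  overCountLowest-b L zero (suc m) _ = overCountLowest-unique L (0 + b * suc m) b m
    (λ v e → suc-injective (proj₂ (divMod-unique {b} {0} {suc v} z<s z<s (trans (*-suc b v) e))))
    (λ v v≡m → trans (sym (*-suc b v)) (cong (λ z → b * suc z) v≡m))
  overCountLowest-b L (suc j) m j<b = overCountLowest-none L (suc j + b * m) b
    (λ v e → 0≢1+n (proj₁ (divMod-unique {b} {0} {suc v} {suc j} {m} z<s j<b (trans (*-suc b v) e))))

  overCountLen-suc-suc : ∀ L j m → j < b → overCountLen (suc (suc L)) (j + b * m) ≡ overCountLen (suc L) m + carry L j m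
  overCountLen-suc-suc L j m j<b = begin
    overCountLen (suc (suc L)) (j + b * m)
      ≡⟨ overCountLen-suc (suc L) (j + b * m) ⟩
    sumUpTo (overCountLowest (suc L) (j + b * m)) (suc b)
      ≡⟨ sumUpTo-cong (suc b) by-lowest-digit ⟩
    sumUpTo (λ d → atJ d + atB d) (suc b)
      ≡⟨ sumUpTo-distrib-+ atJ atB (suc b) ⟩
    sumUpTo atJ (suc b) + sumUpTo atB (suc b)
      ≡⟨ cong₂ _+_ (sumUpTo-delta _ (suc b) (m≤n⇒m≤1+n j<b)) (sumUpTo-delta _ (suc b) ≤-refl) ⟩
    overCountLen (suc L) m + carry L j m ∎
    where
    open ≡-Reasoning
    atJ atB : ℕ → ℕ
    atJ d = if d ≡ᵇ j then overCountLen (suc L) m else 0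
    atB d = if d ≡ᵇ b then carry L j m else 0
    by-lowest-digit : ∀ d → d < suc b → overCountLowest (suc L) (j + b * m) d ≡ atJ d + atB d
    by-lowest-digit d d≤b with d ≟ b
    ... | yes refl rewrite ≡ᵇ-false (<⇒≢ j<b ∘ sym) | ≡ᵇ-true {b} refl = overCountLowest-b L j m j<b
    ... | no d≢b with d ≟ j
    ...   | yes refl rewrite ≡ᵇ-true {d} refl | ≡ᵇ-false d≢b =
      trans (overCountLowest-unique L (d + b * m) d m (λ v e → proj₂ (divMod-unique {b} {d} {v} j<b j<b e))
                                                      (λ v v≡m → cong (λ z → d + b * z) v≡m))
            (sym (+-identityʳ _))
    ...   | no d≢j rewrite ≡ᵇ-false d≢j | ≡ᵇ-false d≢b =
      overCountLowest-none L (j + b * m) d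
        (λ v e → d≢j (proj₁ (divMod-unique {b} {d} {v} {j} {m} (≤∧≢⇒< (≤-pred d≤b) d≢b) j<b e)))

  overCountLen-vanish : ∀ L {N} → N < b ^ L → overCountLen (suc L) N ≡ 0
  overCountLen-vanish zero    {zero}  _        = overCountLen-one-zero
  overCountLen-vanish zero    {suc N} (s<s ())
  overCountLen-vanish (suc L) {N}     N<bᴸ⁺¹ = begin
    overCountLen (suc (suc L)) N
      ≡⟨ cong (overCountLen (suc (suc L))) (m≡m%n+n*[m/n] N b) ⟩
    overCountLen (suc (suc L)) (N % b + b * (N / b))
      ≡⟨ overCountLen-suc-suc L (N % b) (N / b) (m%n<n N b) ⟩
    overCountLen (suc L) (N / b) + carry L (N % b) (N / b)
      ≡⟨ cong₂ _+_ (overCountLen-vanish L N/b<bᴸ) (carry-vanish (N % b) N/b<bᴸ) ⟩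
    0 ∎
    where
    open ≡-Reasoning
    N/b<bᴸ = /b-< L N<bᴸ⁺¹
    carry-vanish : ∀ j {m} → m < b ^ L → carry L j m ≡ 0
    carry-vanish zero    {zero}  _    = refl
    carry-vanish zero    {suc m} m<bᴸ = overCountLen-vanish L (<-trans (n<1+n m) m<bᴸ)
    carry-vanish (suc j)         _    = refl

  overCount≡sumUpTo-< : ∀ B {N} → N < b ^ B → sumUpTo (λ L → overCountLen (suc L) N) B ≡ overCount b N
  overCount≡sumUpTo-< B {N} N<bᴮ = trans (sumUpTo-support B (suc N) beyond-B beyond-N) (sym (overCount≡sumUpTo N))
    where
    beyond-B : ∀ L → B ≤ L → overCountLen (suc L) N ≡ 0
    beyond-B L B≤L = overCountLen-vanish L (<-≤-trans N<bᴮ (^-monoʳ-≤ b B≤L))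
    beyond-N : ∀ L → suc N ≤ L → overCountLen (suc L) N ≡ 0
    beyond-N L N<L = overCountLen-vanish L (<-≤-trans (n<b^n N) (^-monoʳ-≤ b (<⇒≤ N<L)))

  overCount-zero : overCount b 0 ≡ 0
  overCount-zero = sym (overCount≡sumUpTo-< 0 z<s)

  overCount-digits : ∀ j m → j < b →
    overCount b (j + b * m) ≡ overCountLen 1 (j + b * m) + (overCount b m + sumUpTo (λ L → carry L j m) (j + b * m))
  overCount-digits j m j<b = begin
    overCount b N
      ≡⟨ overCount≡sumUpTo-< (suc N) (<-≤-trans (n<b^n N) (^-monoʳ-≤ b (n≤1+n N))) ⟨
    overCountLen 1 N + sumUpTo (λ L → overCountLen (suc (suc L)) N) N
      ≡⟨ cong (overCountLen 1 N +_) (sumUpTo-cong N (λ L _ → overCountLen-suc-suc L j m j<b)) ⟩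
    overCountLen 1 N + sumUpTo (λ L → overCountLen (suc L) m + carry L j m) N
      ≡⟨ cong (overCountLen 1 N +_) (sumUpTo-distrib-+ (λ L → overCountLen (suc L) m) (λ L → carry L j m) N) ⟩
    overCountLen 1 N + (sumUpTo (λ L → overCountLen (suc L) m) N + sumUpTo (λ L → carry L j m) N)
      ≡⟨ cong (λ z → overCountLen 1 N + (z + sumUpTo (λ L → carry L j m) N)) (overCount≡sumUpTo-< N m<bᴺ) ⟩
    overCountLen 1 N + (overCount b m + sumUpTo (λ L → carry L j m) N) ∎
    where
    open ≡-Reasoning
    N = j + b * m
    m<bᴺ : m < b ^ N
    m<bᴺ = ≤-<-trans (≤-trans (m≤m+n m (m + c * m)) (m≤n+m (b * m) j)) (n<b^n N)

  s-nonzero-digit : ∀ j m → suc j < b → s b (suc (suc j + b * m)) ≡ s b (suc m)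
  s-nonzero-digit j zero j<b = begin
    overCount b (suc j + b * 0)
      ≡⟨ overCount-digits (suc j) 0 j<b ⟩
    overCountLen 1 (suc j + b * 0) + (overCount b 0 + sumUpTo (λ L → carry L (suc j) 0) (suc j + b * 0))
      ≡⟨ cong₂ _+_ (overCountLen-one-digit (s≤s z≤n) N≤b) (cong₂ _+_ overCount-zero (sumUpTo-zero (suc j + b * 0) (λ _ _ → refl))) ⟩
    1 ∎
    where
    open ≡-Reasoning
    N≤b : suc j + b * 0 ≤ b
    N≤b = ≤-trans (≤-reflexive (trans (cong (suc j +_) (*-zeroʳ b)) (+-identityʳ (suc j)))) (<⇒≤ j<b)
  s-nonzero-digit j (suc m) j<b = begin
    overCount b (suc j + b * suc m)
      ≡⟨ overCount-digits (suc j) (suc m) j<b ⟩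
    overCountLen 1 (suc j + b * suc m) + (overCount b (suc m) + sumUpTo (λ L → carry L (suc j) (suc m)) (suc j + b * suc m))
      ≡⟨ cong₂ _+_ (overCountLen-one-large b<N) (cong (overCount b (suc m) +_) (sumUpTo-zero (suc j + b * suc m) (λ _ _ → refl))) ⟩
    overCount b (suc m) + 0
      ≡⟨ +-identityʳ _ ⟩
    overCount b (suc m) ∎
    where
    open ≡-Reasoning
    b<N : b < suc j + b * suc m
    b<N = s≤s (≤-trans (≤-trans (m≤m+n b (b * m)) (≤-reflexive (sym (*-suc b m)))) (m≤n+m (b * suc m) j))

  s-zero-digit : ∀ m → s b (suc (b * m)) ≡ s b (suc m) + s b m
  s-zero-digit zero rewrite *-zeroʳ b = refl
  s-zero-digit (suc zero) = begin
    overCount b (b * 1)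
      ≡⟨ overCount-digits 0 1 z<s ⟩
    overCountLen 1 (b * 1) + (overCount b 1 + sumUpTo (λ L → overCountLen (suc L) 0) (b * 1))
      ≡⟨ cong₂ _+_ (overCountLen-one-digit (≤-trans (s≤s z≤n) b≤b*1) (≤-reflexive (*-identityʳ b)))
                   (cong (overCount b 1 +_) (trans (overCount≡sumUpTo-< (b * 1) (m^n>0 b (b * 1))) overCount-zero)) ⟩
    1 + (overCount b 1 + 0)
      ≡⟨ +-comm 1 (overCount b 1 + 0) ⟩
    overCount b 1 + 0 + 1
      ≡⟨ cong (_+ 1) (+-identityʳ (overCount b 1)) ⟩
    overCount b 1 + 1 ∎
    where
    open ≡-Reasoning
    b≤b*1 : b ≤ b * 1
    b≤b*1 = ≤-reflexive (sym (*-identityʳ b))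
  s-zero-digit (suc (suc m)) = begin
    overCount b (b * suc (suc m))
      ≡⟨ overCount-digits 0 (suc (suc m)) z<s ⟩
    overCountLen 1 (b * suc (suc m)) + (overCount b (suc (suc m)) + sumUpTo (λ L → overCountLen (suc L) (suc m)) (b * suc (suc m)))
      ≡⟨ cong₂ _+_ (overCountLen-one-large b<N) (cong (overCount b (suc (suc m)) +_) (overCount≡sumUpTo-< (b * suc (suc m)) m+1<bᴺ)) ⟩
    overCount b (suc (suc m)) + overCount b (suc m) ∎
    where
    open ≡-Reasoning
    b<N : b < b * suc (suc m)
    b<N = subst (b <_) (sym (*-suc b (suc m))) (m<m+n b (s≤s z≤n))
    m+1<bᴺ : suc m < b ^ (b * suc (suc m))
    m+1<bᴺ = <-≤-trans (n<1+n (suc m)) (<⇒≤ (<-≤-trans (n<b^n (suc (suc m))) (^-monoʳ-≤ b (m≤n*m (suc (suc m)) b))))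

  State : Set
  State = ℕ × ℕ

  step : State → ℕ → State
  step (x , y) zero          = x + y , y
  step (x , y) (suc zero)    = x , x + y
  step (x , y) (suc (suc _)) = x , x

  -- run v n R feeds the n lowest digits of R to step, the most significant one first.
  run : State → ℕ → ℕ → State
  run v zero    R = v
  run v (suc n) R = step (run v n (R / b)) (R % b)

  step-s : ∀ j m → j < b → step (s b (suc m) , s b m) j ≡ (s b (suc (j + b * m)) , s b (j + b * m))
  step-s zero m _ = cong₂ _,_ (sym (s-zero-digit m)) (s-times-b m)
    where
    s-times-b : ∀ m → s b m ≡ s b (b * m)
    s-times-b zero    rewrite *-zeroʳ b = refl
    s-times-b (suc m) = sym (trans (cong (s b) (*-suc b m)) (s-nonzero-digit c m ≤-refl))
  step-s (suc zero)    m j<b = cong₂ _,_ (sym (s-nonzero-digit 0 m j<b)) (sym (s-zero-digit m))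
  step-s (suc (suc j)) m j<b = cong₂ _,_ (sym (s-nonzero-digit (suc j) m j<b)) (sym (s-nonzero-digit j m (<-trans (n<1+n _) j<b)))

  run-s : ∀ n N → N < b ^ n → run (1 , 0) n N ≡ (s b (suc N) , s b N)
  run-s zero    zero    _ = refl
  run-s zero    (suc N) (s<s ())
  run-s (suc n) N       N<bⁿ⁺¹ = begin
    step (run (1 , 0) n (N / b)) (N % b)      ≡⟨ cong (λ v → step v (N % b)) (run-s n (N / b) (/b-< n N<bⁿ⁺¹)) ⟩
    step (s b (suc (N / b)) , s b (N / b)) (N % b)
      ≡⟨ step-s (N % b) (N / b) (m%n<n N b) ⟩
    (s b (suc (N % b + b * (N / b))) , s b (N % b + b * (N / b)))
      ≡⟨ cong (λ z → s b (suc z) , s b z) (m≡m%n+n*[m/n] N b) ⟨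
    (s b (suc N) , s b N) ∎
    where open ≡-Reasoning

  run-++ : ∀ m v n P R → R < b ^ m → run v (n + m) (P * b ^ m + R) ≡ run (run v n P) m R
  run-++ zero v n P zero _ = cong₂ (run v) (+-identityʳ n) (trans (+-identityʳ (P * 1)) (*-identityʳ P))
  run-++ zero v n P (suc R) (s<s ())
  run-++ (suc m) v n P R R<bᵐ⁺¹ = begin
    run v (n + suc m) (P * b ^ suc m + R)
      ≡⟨ cong (λ k → run v k (P * b ^ suc m + R)) (+-suc n m) ⟩
    step (run v (n + m) ((P * b ^ suc m + R) / b)) ((P * b ^ suc m + R) % b)
      ≡⟨ cong₂ (λ u w → step (run v (n + m) u) w) (shift-/ P m R) (shift-% P m R) ⟩
    step (run v (n + m) (P * b ^ m + R / b)) (R % b)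
      ≡⟨ cong (λ u → step u (R % b)) (run-++ m v n P (R / b) (/b-< m R<bᵐ⁺¹)) ⟩
    step (run (run v n P) m (R / b)) (R % b) ∎
    where open ≡-Reasoning

  run-lead : ∀ n v {d L} → d < b → L < b ^ n → run v (suc n) (d * b ^ n + L) ≡ run (step v d) n L
  run-lead n v {d} {L} d<b L<bⁿ = trans (run-++ n v 1 d L L<bⁿ) (cong (λ e → run (step v e) n L) (m<n⇒m%n≡m d<b))

  run-positive : ∀ n v R → 1 ≤ proj₁ v → 1 ≤ proj₁ (run v n R)
  run-positive zero    v R h = h
  run-positive (suc n) v R h = step-positive (run v n (R / b)) (R % b) (run-positive n v (R / b) h)
    where
    step-positive : ∀ v d → 1 ≤ proj₁ v → 1 ≤ proj₁ (step v d)
    step-positive (x , y) zero          h = ≤-trans h (m≤m+n x y)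
    step-positive (x , y) (suc zero)    h = h
    step-positive (x , y) (suc (suc d)) h = h

  score : State → ℕ → ℕ → ℕ
  score v n R = proj₁ (run v n R)

  score-lead : ∀ n v {d L} → d < b → L < b ^ n → score v (suc n) (d * b ^ n + L) ≡ score (step v d) n L
  score-lead n v d<b L<bⁿ = cong proj₁ (run-lead n v d<b L<bⁿ)

  step-bounded : ∀ {x y a a′} d → x ≤ a → y ≤ a → (x ≤ a′ ⊎ y ≤ a′) →
    let (x′ , y′) = step (x , y) d in x′ ≤ a + a′ × y′ ≤ a + a′ × (x′ ≤ a ⊎ y′ ≤ a)
  step-bounded {x} {y} {a} {a′} d x≤a y≤a one≤a′ = by-digit d
    where
    x+y≤a+a′ : x + y ≤ a + a′
    x+y≤a+a′ = [ (λ x≤a′ → ≤-trans (+-mono-≤ x≤a′ y≤a) (≤-reflexive (+-comm a′ a))) , +-mono-≤ x≤a ] one≤a′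
    x≤a+a′ : x ≤ a + a′
    x≤a+a′ = ≤-trans x≤a (m≤m+n a a′)
    by-digit : ∀ d → let (x′ , y′) = step (x , y) d in x′ ≤ a + a′ × y′ ≤ a + a′ × (x′ ≤ a ⊎ y′ ≤ a)
    by-digit zero        = x+y≤a+a′ , ≤-trans y≤a (m≤m+n a a′) , inj₂ y≤a
    by-digit (suc zero)  = x≤a+a′ , x+y≤a+a′ , inj₁ x≤a
    by-digit (suc (suc _)) = x≤a+a′ , x≤a+a′ , inj₁ x≤a

  score-≤ : ∀ n v {a a′} R → R < b ^ n → proj₁ v ≤ a → proj₂ v ≤ a → (proj₁ v ≤ a′ ⊎ proj₂ v ≤ a′) →
    score v n R ≤ fib (suc n) * a + fib n * a′
  score-≤ zero    v {a} R _ x≤a _ _ = ≤-trans x≤a (≤-trans (m≤m+n a 0) (m≤m+n (a + 0) 0))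
  score-≤ (suc n) (x , y) {a} {a′} R R<bⁿ⁺¹ x≤a y≤a one≤a′ with split-leading n R R<bⁿ⁺¹
  ... | d , L , d<b , L<bⁿ , refl with step-bounded d x≤a y≤a one≤a′
  ...   | x′≤ , y′≤ , one′≤a = begin
    score (x , y) (suc n) (d * b ^ n + L)     ≡⟨ score-lead n (x , y) d<b L<bⁿ ⟩
    score (step (x , y) d) n L                ≤⟨ score-≤ n (step (x , y) d) L L<bⁿ x′≤ y′≤ one′≤a ⟩
    fib (suc n) * (a + a′) + fib n * a        ≡⟨ ring (fib (suc n)) (fib n) a a′ ⟩
    fib (suc (suc n)) * a + fib (suc n) * a′  ∎
    where
    open ≤-Reasoning
    ring : ∀ f₁ f₀ a a′ → f₁ * (a + a′) + f₀ * a ≡ (f₁ + f₀) * a + f₁ * a′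
    ring = solve-∀

  score-attains : ∀ n x y → ∃[ R ] (R < b ^ n × fib (suc n) * x + fib n * y ≤ score (x , y) n R)
  score-attains zero x y = 0 , z<s , ≤-reflexive (trans (+-identityʳ _) (+-identityʳ x))
  score-attains (suc zero) x y = 0 * 1 + 0 , z<s ,
    subst (1 * x + 1 * y ≤_) (sym (score-lead 0 (x , y) z<s z<s)) (≤-reflexive (cong₂ _+_ (+-identityʳ x) (+-identityʳ y)))
  score-attains (suc (suc n)) x y with score-attains n (x + (x + y)) (x + y)
  ... | W , W<bⁿ , attained = 1 * b ^ suc n + R₀ , lead-+-< (suc n) (s<s z<s) R₀<bⁿ⁺¹ , (begin
    fib (suc (suc (suc n))) * x + fib (suc (suc n)) * y    ≡⟨ ring (fib (suc n)) (fib n) x y ⟩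
    fib (suc n) * (x + (x + y)) + fib n * (x + y)          ≤⟨ attained ⟩
    score (x + (x + y) , x + y) n W                        ≡⟨ score-lead n (x , x + y) z<s W<bⁿ ⟨
    score (x , x + y) (suc n) R₀                           ≡⟨ score-lead (suc n) (x , y) (s<s z<s) R₀<bⁿ⁺¹ ⟨
    score (x , y) (suc (suc n)) (1 * b ^ suc n + R₀)       ∎)
    where
    open ≤-Reasoning
    R₀ = 0 * b ^ n + W
    R₀<bⁿ⁺¹ = lead-+-< n z<s W<bⁿ
    ring : ∀ f₁ f₀ x y → ((f₁ + f₀) + f₁) * x + (f₁ + f₀) * y ≡ f₁ * (x + (x + y)) + f₀ * (x + y)
    ring = solve-∀

  score-attains-lead-0 : ∀ n p q → ∃[ W ] (W < b ^ suc n × fib (suc (suc n)) * q + fib (suc n) * p ≤ score (p , q) (suc n) W)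
  score-attains-lead-0 n p q with score-attains n (p + q) q
  ... | W , W<bⁿ , attained = 0 * b ^ n + W , lead-+-< n z<s W<bⁿ , (begin
    fib (suc (suc n)) * q + fib (suc n) * p   ≡⟨ ring (fib (suc n)) (fib n) p q ⟩
    fib (suc n) * (p + q) + fib n * q         ≤⟨ attained ⟩
    score (p + q , q) n W                     ≡⟨ score-lead n (p , q) z<s W<bⁿ ⟨
    score (p , q) (suc n) (0 * b ^ n + W)     ∎)
    where
    open ≤-Reasoning
    ring : ∀ f₁ f₀ p q → (f₁ + f₀) * q + f₁ * p ≡ f₁ * (p + q) + f₀ * q
    ring = solve-∀

  FirstMax : State → ℕ → ℕ → Set
  FirstMax v m R =
    R < b ^ m × (∀ R′ → R′ < b ^ m → score v m R′ ≤ score v m R) × (∀ R′ → R′ < R → score v m R′ < score v m R)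

  FirstMax-tail : ∀ v m {d L} → d < b → L < b ^ m → FirstMax v (suc m) (d * b ^ m + L) → FirstMax (step v d) m L
  FirstMax-tail v m {d} {L} d<b L<bᵐ (_ , max , first) = L<bᵐ ,
    (λ R′ R′<bᵐ → subst₂ _≤_ (score-lead m v d<b R′<bᵐ) (score-lead m v d<b L<bᵐ)
                    (max (d * b ^ m + R′) (lead-+-< m d<b R′<bᵐ))) ,
    (λ R′ R′<L → subst₂ _<_ (score-lead m v d<b (<-trans R′<L L<bᵐ)) (score-lead m v d<b L<bᵐ)
                    (first (d * b ^ m + R′) (+-monoʳ-< (d * b ^ m) R′<L)))

  step-nonzero : ∀ x y d → proj₁ (step (x , y) (suc d)) ≡ x × proj₂ (step (x , y) (suc d)) ≤ x + y
  step-nonzero x y zero    = refl , ≤-refl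
  step-nonzero x y (suc d) = refl , m≤m+n x y

  FirstMax-lead-0 : ∀ m {p q d L} → p ≤ q → d < b → L < b ^ m → FirstMax (p , q) (suc m) (d * b ^ m + L) → d ≡ 0
  FirstMax-lead-0 m {d = zero} _ _ _ _ = refl
  FirstMax-lead-0 m {p} {q} {suc d} {L} p≤q d<b L<bᵐ (_ , _ , first) with score-attains m (p + q) q
  ... | W , W<bᵐ , attained = ⊥-elim (<-irrefl refl (begin-strict
    score (p , q) (suc m) R₀                 <⟨ first R₀ R₀<R ⟩
    score (p , q) (suc m) (suc d * b ^ m + L) ≡⟨ score-lead m (p , q) d<b L<bᵐ ⟩
    score (step (p , q) (suc d)) m L         ≤⟨ score-≤ m (step (p , q) (suc d)) L L<bᵐ x′≤ y′≤ (inj₁ (≤-reflexive x′≡p)) ⟩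
    fib (suc m) * (p + q) + fib m * p        ≤⟨ +-monoʳ-≤ (fib (suc m) * (p + q)) (*-monoʳ-≤ (fib m) p≤q) ⟩
    fib (suc m) * (p + q) + fib m * q        ≤⟨ attained ⟩
    score (p + q , q) m W                    ≡⟨ score-lead m (p , q) z<s W<bᵐ ⟨
    score (p , q) (suc m) R₀                 ∎))
    where
    open ≤-Reasoning
    R₀ = 0 * b ^ m + W
    R₀<R : R₀ < suc d * b ^ m + L
    R₀<R = <-≤-trans W<bᵐ (≤-trans (m≤m+n (b ^ m) (d * b ^ m)) (m≤m+n _ L))
    x′≡p = proj₁ (step-nonzero p q d)
    x′≤ = ≤-trans (≤-reflexive x′≡p) (m≤m+n p q)
    y′≤ = proj₂ (step-nonzero p q d)

  FirstMax-lead-≥2 : ∀ m {x y d L} → suc (suc d) < b → L < b ^ suc m →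
    ¬ FirstMax (x , y) (suc (suc m)) (suc (suc d) * b ^ suc m + L)
  FirstMax-lead-≥2 m {x} {y} {d} {L} d<b L<bᵐ⁺¹ (_ , _ , first) with score-attains-lead-0 m x (x + y)
  ... | W , W<bᵐ⁺¹ , attained = <-irrefl refl (begin-strict
    score (x , y) (suc (suc m)) R₁                         <⟨ first R₁ R₁<R ⟩
    score (x , y) (suc (suc m)) (suc (suc d) * q + L)      ≡⟨ score-lead (suc m) (x , y) d<b L<bᵐ⁺¹ ⟩
    score (x , x) (suc m) L                                ≤⟨ score-≤ (suc m) (x , x) L L<bᵐ⁺¹ ≤-refl ≤-refl (inj₁ ≤-refl) ⟩
    fib (suc (suc m)) * x + fib (suc m) * x                ≤⟨ +-monoˡ-≤ (fib (suc m) * x) (*-monoʳ-≤ (fib (suc (suc m))) (m≤m+n x y)) ⟩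
    fib (suc (suc m)) * (x + y) + fib (suc m) * x          ≤⟨ attained ⟩
    score (x , x + y) (suc m) W                            ≡⟨ score-lead (suc m) (x , y) (s<s z<s) W<bᵐ⁺¹ ⟨
    score (x , y) (suc (suc m)) R₁                         ∎)
    where
    open ≤-Reasoning
    q = b ^ suc m
    R₁ = 1 * q + W
    R₁<R : R₁ < suc (suc d) * q + L
    R₁<R = ≤-trans (+-monoʳ-< (1 * q) W<bᵐ⁺¹) (≤-trans (≤-reflexive (ring q)) (≤-trans (+-monoʳ-≤ q (+-monoʳ-≤ q z≤n)) (m≤m+n _ L)))
      where
      ring : ∀ q → 1 * q + q ≡ q + (q + 0)
      ring = solve-∀

  FirstMax-lead-nonzero : ∀ m {x y L} → y < x → L < b ^ suc m → ¬ FirstMax (x , y) (suc (suc m)) (0 * b ^ suc m + L)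
  FirstMax-lead-nonzero m {x} {y} {L} y<x L<bᵐ⁺¹ (_ , max , _) with score-attains-lead-0 m x (x + y)
  ... | W , W<bᵐ⁺¹ , attained = <-irrefl refl (begin-strict
    score (x , y) (suc (suc m)) R₁                   ≤⟨ max R₁ (lead-+-< (suc m) (s<s z<s) W<bᵐ⁺¹) ⟩
    score (x , y) (suc (suc m)) (0 * q + L)          ≡⟨ score-lead (suc m) (x , y) z<s L<bᵐ⁺¹ ⟩
    score (x + y , y) (suc m) L                      ≤⟨ score-≤ (suc m) (x + y , y) L L<bᵐ⁺¹ ≤-refl (m≤n+m y x) (inj₂ ≤-refl) ⟩
    fib (suc (suc m)) * (x + y) + fib (suc m) * y    <⟨ +-monoʳ-< (fib (suc (suc m)) * (x + y)) (*-monoʳ-< (fib (suc m)) {{>-nonZero (fib-suc-positive m)}} y<x) ⟩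
    fib (suc (suc m)) * (x + y) + fib (suc m) * x    ≤⟨ attained ⟩
    score (x , x + y) (suc m) W                      ≡⟨ score-lead (suc m) (x , y) (s<s z<s) W<bᵐ⁺¹ ⟨
    score (x , y) (suc (suc m)) R₁                   ∎)
    where
    open ≤-Reasoning
    q = b ^ suc m
    R₁ = 1 * q + W

  FirstMax-lead-1 : ∀ m {x y d L} → y < x → d < b → L < b ^ suc m → FirstMax (x , y) (suc (suc m)) (d * b ^ suc m + L) → d ≡ 1
  FirstMax-lead-1 m {d = zero}        y<x _   L<bᵐ⁺¹ fm = ⊥-elim (FirstMax-lead-nonzero m y<x L<bᵐ⁺¹ fm)
  FirstMax-lead-1 m {d = suc zero}    _   _   _      _  = refl
  FirstMax-lead-1 m {d = suc (suc d)} _   d<b L<bᵐ⁺¹ fm = ⊥-elim (FirstMax-lead-≥2 m d<b L<bᵐ⁺¹ fm)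

  FirstMax-peel-0 : ∀ m {p q R} → p ≤ q → FirstMax (p , q) (suc m) R →
    ∃[ R₁ ] (R₁ < b ^ m × R ≡ 0 * b ^ m + R₁ × FirstMax (p + q , q) m R₁)
  FirstMax-peel-0 m {p} {q} p≤q fm with split-leading m _ (proj₁ fm)
  ... | d , R₁ , d<b , R₁< , refl with FirstMax-lead-0 m p≤q d<b R₁< fm
  ... | refl = R₁ , R₁< , refl , FirstMax-tail (p , q) m d<b R₁< fm

  FirstMax-peel-1 : ∀ m {x y R} → y < x → FirstMax (x , y) (suc (suc m)) R →
    ∃[ R₁ ] (R₁ < b ^ suc m × R ≡ 1 * b ^ suc m + R₁ × FirstMax (x , x + y) (suc m) R₁)
  FirstMax-peel-1 m {x} {y} y<x fm with split-leading (suc m) _ (proj₁ fm)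
  ... | d , R₁ , d<b , R₁< , refl with FirstMax-lead-1 m y<x d<b R₁< fm
  ... | refl = R₁ , R₁< , refl , FirstMax-tail (x , y) (suc m) d<b R₁< fm

  FirstMax-top-digit : ∀ m {p q R} → p ≤ q → FirstMax (p , q) (suc m) R → digit b R m ≡ 0
  FirstMax-top-digit m p≤q fm =
    let (R₁ , R₁< , R≡ , _) = FirstMax-peel-0 m p≤q fm in
    trans (cong (λ z → digit b z m) R≡) (digit-lead m z<s R₁<)

  Alternating : ℕ → ℕ → Set
  Alternating m R = ∀ {i} → 1 ≤ i → suc i < m → digit b R i ≢ digit b R (suc i)

  Alternating-cons : ∀ m {R} → R < b ^ suc m → Alternating (suc m) R → digit b R m ≡ 0 →
    Alternating (suc (suc (suc m))) (0 * b ^ suc (suc m) + (1 * b ^ suc m + R))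
  Alternating-cons m {R} R<bᵐ⁺¹ alt digit-m≡0 {i} 1≤i i+1<m+3 = by-position (<-cmp i m)
    where
    R′ = 0 * b ^ suc (suc m) + (1 * b ^ suc m + R)
    low : ∀ {j} → j < suc m → digit b R′ j ≡ digit b R j
    low j<m+1 = trans (digit-low 0 (1 * b ^ suc m + R) (m<n⇒m<1+n j<m+1)) (digit-low 1 R j<m+1)
    digit-m+1 : digit b R′ (suc m) ≡ 1
    digit-m+1 = trans (digit-low {suc m} 0 (1 * b ^ suc m + R) ≤-refl) (digit-lead (suc m) (s<s z<s) R<bᵐ⁺¹)
    digit-m+2 : digit b R′ (suc (suc m)) ≡ 0
    digit-m+2 = digit-lead (suc (suc m)) z<s (lead-+-< (suc m) (s<s z<s) R<bᵐ⁺¹)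
    by-position : Tri (i < m) (i ≡ m) (m < i) → digit b R′ i ≢ digit b R′ (suc i)
    by-position (tri< i<m _ _) e = alt 1≤i (s<s i<m) (trans (sym (low (m<n⇒m<1+n i<m))) (trans e (low (s<s i<m))))
    by-position (tri≈ _ refl _) e = 0≢1+n (trans (sym digit-m≡0) (trans (sym (low ≤-refl)) (trans e digit-m+1)))
    by-position (tri> _ _ m<i) e with ≤-antisym (≤-pred (≤-pred i+1<m+3)) m<i
    ... | refl = 0≢1+n (trans (sym digit-m+2) (trans (sym e) digit-m+1))

  mutual
    FirstMax-alternating : ∀ m {p q R} → 1 ≤ p → p ≤ q → FirstMax (p , q) m R → Alternating m R
    FirstMax-alternating (suc (suc (suc m))) {p} {q} 1≤p p≤q fm =
      let (_ , _ , R≡ , fm₁) = FirstMax-peel-0 (suc (suc m)) p≤q fm in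
      subst (Alternating (suc (suc (suc m)))) (sym R≡) (FirstMax-alternating-lead-1 (suc m) (m<n+m q 1≤p) fm₁)
    FirstMax-alternating zero             _ _ _ _ ()
    FirstMax-alternating (suc zero)       _ _ _ _ (s<s ())
    FirstMax-alternating (suc (suc zero)) _ _ _ (s≤s z≤n) (s<s (s<s ()))

    FirstMax-alternating-lead-1 : ∀ n {x y R} → y < x → FirstMax (x , y) (suc n) R →
      Alternating (suc (suc n)) (0 * b ^ suc n + R)
    FirstMax-alternating-lead-1 (suc m) {x} {y} y<x fm =
      let (R₁ , R₁< , R≡ , fm₁) = FirstMax-peel-1 m y<x fm in
      subst (λ R → Alternating (suc (suc (suc m))) (0 * b ^ suc (suc m) + R)) (sym R≡)
        (Alternating-cons m R₁< (FirstMax-alternating (suc m) (≤-trans (s≤s z≤n) y<x) (m≤m+n x y) fm₁)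
                                (FirstMax-top-digit m (m≤m+n x y) fm₁))
    FirstMax-alternating-lead-1 zero _ _ (s≤s z≤n) (s<s (s<s ()))

  nonzeroDigit : ℕ → ℕ → Bool
  nonzeroDigit N i = not (digit b N i ≡ᵇ 0)

  exps-zero : exps b 0 ≡ []
  exps-zero = trans (filterᵇ-∷ (nonzeroDigit 0) 0 [])
    (cong (λ z → (if not (z ≡ᵇ 0) then 0 ∷ [] else []) ++ []) (digit-small {0} 0 z<s))

  exps-upTo : ∀ {N B} → suc N ≤ B → filterᵇ (nonzeroDigit N) (upTo B) ≡ exps b N
  exps-upTo {N} N<B = trans (cong (filterᵇ (nonzeroDigit N) ∘ upTo) (sym (m+[n∸m]≡n N<B)))
    (filterᵇ-pad (nonzeroDigit N) id (suc N) _ (λ i N<i → cong (λ z → not (z ≡ᵇ 0)) (digit-small i (<-trans N<i (n<b^n i)))))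

  exps-/b : ∀ N → exps b N ≡ (if nonzeroDigit N 0 then 0 ∷ [] else []) ++ map suc (exps b (N / b))
  exps-/b N = trans (filterᵇ-∷ (nonzeroDigit N) 0 (applyUpTo suc N)) (cong ((if nonzeroDigit N 0 then 0 ∷ [] else []) ++_) (begin
    filterᵇ (nonzeroDigit N) (applyUpTo suc N)               ≡⟨ cong (filterᵇ (nonzeroDigit N)) (map-upTo suc N) ⟨
    filterᵇ (nonzeroDigit N) (map suc (upTo N))              ≡⟨ filterᵇ-map (nonzeroDigit N) suc (upTo N) ⟩
    map suc (filterᵇ (nonzeroDigit N ∘ suc) (upTo N))        ≡⟨ cong (map suc) (filterᵇ-cong (upTo N) (λ i → cong (λ z → not (z ≡ᵇ 0)) (digit-suc N i))) ⟩
    map suc (filterᵇ (nonzeroDigit (N / b)) (upTo N))        ≡⟨ cong (map suc) (tail N) ⟩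
    map suc (exps b (N / b))                                 ∎))
    where
    open ≡-Reasoning
    tail : ∀ N → filterᵇ (nonzeroDigit (N / b)) (upTo N) ≡ exps b (N / b)
    tail zero    = sym (trans (cong (exps b) (0/n≡0 b)) exps-zero)
    tail (suc n) = exps-upTo (m/n<m (suc n) b (s<s z<s))

  exps-split : ∀ n A Y → Y < b ^ n → exps b (A * b ^ n + Y) ≡ exps b Y ++ map (n +_) (exps b A)
  exps-split zero A zero _ = begin
    exps b (A * 1 + 0)                  ≡⟨ cong (exps b) (trans (+-identityʳ (A * 1)) (*-identityʳ A)) ⟩
    exps b A                            ≡⟨ map-id (exps b A) ⟨
    map (0 +_) (exps b A)               ≡⟨ cong (_++ map (0 +_) (exps b A)) exps-zero ⟨
    exps b 0 ++ map (0 +_) (exps b A)   ∎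
    where open ≡-Reasoning
  exps-split zero A (suc Y) (s<s ())
  exps-split (suc n) A Y Y<bⁿ⁺¹ = begin
    exps b X
      ≡⟨ exps-/b X ⟩
    low X ++ map suc (exps b (X / b))
      ≡⟨ cong₂ (λ u v → u ++ map suc v) same-low (trans (cong (exps b) (shift-/ A n Y)) (exps-split n A (Y / b) (/b-< n Y<bⁿ⁺¹))) ⟩
    low Y ++ map suc (exps b (Y / b) ++ map (n +_) (exps b A))
      ≡⟨ cong (low Y ++_) (trans (map-++ suc (exps b (Y / b)) _) (cong (map suc (exps b (Y / b)) ++_) (sym (map-∘ (exps b A))))) ⟩
    low Y ++ (map suc (exps b (Y / b)) ++ map (suc n +_) (exps b A))
      ≡⟨ ++-assoc (low Y) (map suc (exps b (Y / b))) _ ⟨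
    (low Y ++ map suc (exps b (Y / b))) ++ map (suc n +_) (exps b A)
      ≡⟨ cong (_++ map (suc n +_) (exps b A)) (exps-/b Y) ⟨
    exps b Y ++ map (suc n +_) (exps b A) ∎
    where
    open ≡-Reasoning
    X = A * b ^ suc n + Y
    low : ℕ → List ℕ
    low N = if nonzeroDigit N 0 then 0 ∷ [] else []
    same-low : low X ≡ low Y
    same-low = cong (λ z → if not (z ≡ᵇ 0) then 0 ∷ [] else [])
      (trans (digit-zero X) (trans (shift-% A n Y) (sym (digit-zero Y))))

  exps-digit : ∀ {d} → 1 ≤ d → d < b → exps b d ≡ 0 ∷ []
  exps-digit {suc d} _ d<b = trans (exps-/b (suc d))
    (cong₂ (λ z v → (if not (z ≡ᵇ 0) then 0 ∷ [] else []) ++ map suc v)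
      (trans (digit-zero (suc d)) (m<n⇒m%n≡m d<b)) (trans (cong (exps b) (m<n⇒m/n≡0 d<b)) exps-zero))

  exps-lead : ∀ p {d Y} → 1 ≤ d → d < b → Y < b ^ p → exps b (d * b ^ p + Y) ≡ exps b Y ++ p ∷ []
  exps-lead p {d} {Y} 1≤d d<b Y<bᵖ = trans (exps-split p d Y Y<bᵖ)
    (cong (exps b Y ++_) (trans (cong (map (p +_)) (exps-digit 1≤d d<b)) (cong (_∷ []) (+-identityʳ p))))

  split-top : ∀ n {Q} → 1 ≤ Q → Q < b ^ suc n →
    ∃[ p ] ∃[ d ] ∃[ Q′ ] (1 ≤ d × d < b × Q′ < b ^ p × Q ≡ d * b ^ p + Q′)
  split-top n {Q} 1≤Q Q<bⁿ⁺¹ with Q <? b ^ n | split-leading n Q Q<bⁿ⁺¹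
  split-top zero    1≤Q _ | yes Q<1  | _ = ⊥-elim (<⇒≱ Q<1 1≤Q)
  split-top (suc n) 1≤Q _ | yes Q<bⁿ | _ = split-top n 1≤Q Q<bⁿ
  split-top n       _   _ | no Q≮bⁿ  | zero  , L , _   , L<bⁿ , refl = ⊥-elim (Q≮bⁿ L<bⁿ)
  split-top n       _   _ | no _     | suc d , L , d<b , L<bⁿ , refl = n , suc d , L , s≤s z≤n , d<b , L<bⁿ , refl

  exps-top : ∀ {Q} → 1 ≤ Q →
    ∃[ p ] ∃[ d ] ∃[ Q′ ] (1 ≤ d × d < b × Q′ < b ^ p × Q ≡ d * b ^ p + Q′ × exps b Q ≡ exps b Q′ ++ p ∷ [])
  exps-top {Q} 1≤Q with split-top Q 1≤Q (<-≤-trans (n<b^n Q) (^-monoʳ-≤ b (n≤1+n Q)))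
  ... | p , d , Q′ , 1≤d , d<b , Q′<bᵖ , refl = p , d , Q′ , 1≤d , d<b , Q′<bᵖ , refl , exps-lead p 1≤d d<b Q′<bᵖ

  geom : ℕ → ℕ → ℕ
  geom r zero    = b ^ r
  geom r (suc y) = b ^ r + geom (r ∸ 2) y

  geomSum≡geom : ∀ r y → geomSum b r y ≡ geom r y
  geomSum≡geom r y = trans (cong sum (map-upTo (λ i → b ^ (r ∸ 2 * i)) (suc y))) (sumUpTo≡geom r y)
    where
    sumUpTo≡geom : ∀ r y → sumUpTo (λ i → b ^ (r ∸ 2 * i)) (suc y) ≡ geom r y
    sumUpTo≡geom r zero    = +-identityʳ (b ^ r)
    sumUpTo≡geom r (suc y) = cong (b ^ r +_) (trans
      (sumUpTo-cong (suc y) (λ i _ → cong (b ^_) (trans (cong (r ∸_) (*-suc 2 i)) (sym (∸-+-assoc r 2 (2 * i))))))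
      (sumUpTo≡geom (r ∸ 2) y))

  b^r≤geom : ∀ r y → b ^ r ≤ geom r y
  b^r≤geom r zero    = ≤-refl
  b^r≤geom r (suc y) = m≤m+n (b ^ r) _

  geom<2b^r : ∀ r y → 2 * y < r → geom r y < b ^ r + b ^ r
  geom<2b^r r             zero    _      = m<m+n (b ^ r) (m^n>0 b r)
  geom<2b^r (suc (suc r)) (suc y) 2y+2<r = +-monoʳ-< (b ^ suc (suc r)) (begin-strict
    geom r y            <⟨ geom<2b^r r y (≤-pred (≤-pred (subst (_< suc (suc r)) (*-suc 2 y) 2y+2<r))) ⟩
    b ^ r + b ^ r       ≤⟨ x+x≤b*x (b ^ r) ⟩
    b ^ suc r           ≤⟨ m≤n*m (b ^ suc r) b ⟩
    b ^ suc (suc r)     ∎)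
    where open ≤-Reasoning
  geom<2b^r (suc zero) (suc y) (s<s 2y+2<0) = ⊥-elim (<⇒≱ (subst (0 <_) (sym (*-suc 2 y)) z<s) 2y+2<0)

  geom≤b^k : ∀ {r y k} → 2 * y < r → r < k → geom r y ≤ b ^ k
  geom≤b^k {r} {y} 2y<r r<k = ≤-trans (<⇒≤ (geom<2b^r r y 2y<r)) (≤-trans (x+x≤b*x (b ^ r)) (^-monoʳ-≤ b r<k))

  geom-leading : ∀ {r y p d Q′} → 2 * y < r → d * b ^ p + Q′ < geom r y → 1 ≤ d → r < suc p →
    p ≡ r × d ≡ 1 × ∃[ y′ ] (y ≡ suc y′)
  geom-leading {r} {y} {p} {d} {Q′} 2y<r Q<G 1≤d r<p+1 = p≡r , d≡1 d 1≤d Q<G , y-suc y Q<G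
    where
    open ≤-Reasoning
    Q = d * b ^ p + Q′
    bᵖ≤Q : b ^ p ≤ Q
    bᵖ≤Q = ≤-trans (≤-trans (≤-reflexive (sym (*-identityˡ (b ^ p)))) (*-monoˡ-≤ (b ^ p) 1≤d)) (m≤m+n _ Q′)
    p≡r : p ≡ r
    p≡r = ≤-antisym (≮⇒≥ (λ r<p → <-irrefl refl (begin-strict
      Q                 <⟨ <-trans Q<G (geom<2b^r r y 2y<r) ⟩
      b ^ r + b ^ r     ≤⟨ x+x≤b*x (b ^ r) ⟩
      b ^ suc r         ≤⟨ ^-monoʳ-≤ b r<p ⟩
      b ^ p             ≤⟨ bᵖ≤Q ⟩
      Q                 ∎))) (≤-pred r<p+1)
    d≡1 : ∀ d → 1 ≤ d → d * b ^ p + Q′ < geom r y → d ≡ 1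
    d≡1 (suc zero)     _ _   = refl
    d≡1 (suc (suc d′)) _ Q<G = ⊥-elim (<-irrefl refl (begin-strict
      b ^ r + b ^ r                          ≡⟨ cong (λ e → b ^ e + b ^ e) p≡r ⟨
      b ^ p + b ^ p                          ≤⟨ +-monoʳ-≤ (b ^ p) (m≤m+n (b ^ p) (d′ * b ^ p)) ⟩
      suc (suc d′) * b ^ p                   ≤⟨ m≤m+n _ Q′ ⟩
      suc (suc d′) * b ^ p + Q′              <⟨ Q<G ⟩
      geom r y                               <⟨ geom<2b^r r y 2y<r ⟩
      b ^ r + b ^ r                          ∎))
    y-suc : ∀ y → Q < geom r y → ∃[ y′ ] (y ≡ suc y′)
    y-suc zero     Q<bʳ = ⊥-elim (<⇒≱ Q<bʳ (subst (λ e → b ^ e ≤ Q) p≡r bᵖ≤Q))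
    y-suc (suc y′) _    = y′ , refl

  -- Q has digit 0 at position E + 1, and every change of its digits below E + 1 stays below G.
  Block : ℕ → ℕ → ℕ → Set
  Block G Q E = ∃[ A ] ∃[ R ] (R < b ^ suc E × Q ≡ A * b ^ suc (suc E) + R × A * b ^ suc (suc E) + b ^ suc E ≤ G)

  Block-cons : ∀ {r G Q E} → suc (suc E) ≤ r → Block G Q E → Block (b ^ r + G) (1 * b ^ r + Q) E
  Block-cons {r} {G} {Q} {E} E+2≤r (A , R , R< , Q≡ , in-G) = b ^ K + A , R , R< , Q′≡ , in-G′
    where
    K = r ∸ suc (suc E)
    X = b ^ suc (suc E)
    bʳ≡ : b ^ r ≡ b ^ K * X
    bʳ≡ = trans (cong (b ^_) (sym (m∸n+n≡m E+2≤r))) (^-distribˡ-+-* b K (suc (suc E)))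
    ring₁ : ∀ Y X A R → 1 * (Y * X) + (A * X + R) ≡ (Y + A) * X + R
    ring₁ = solve-∀
    ring₂ : ∀ Y X A B → (Y + A) * X + B ≡ Y * X + (A * X + B)
    ring₂ = solve-∀
    Q′≡ : 1 * b ^ r + Q ≡ (b ^ K + A) * X + R
    Q′≡ = trans (cong₂ (λ u v → 1 * u + v) bʳ≡ Q≡) (ring₁ (b ^ K) X A R)
    in-G′ : (b ^ K + A) * X + b ^ suc E ≤ b ^ r + G
    in-G′ = ≤-trans (≤-reflexive (trans (ring₂ (b ^ K) X A (b ^ suc E)) (cong (_+ _) (sym bʳ≡)))) (+-monoʳ-≤ (b ^ r) in-G)

  x+2*0+1≡1+x : ∀ x → x + 2 * 0 + 1 ≡ suc x
  x+2*0+1≡1+x = solve-∀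

  2*[1+y]<r⇒r≡2+ : ∀ y {r} → 2 * suc y < r → ∃[ r₂ ] (r ≡ suc (suc r₂))
  2*[1+y]<r⇒r≡2+ y {suc (suc r₂)} _ = r₂ , refl
  2*[1+y]<r⇒r≡2+ y {suc zero} (s<s 2y+1<0) = ⊥-elim (<⇒≱ (subst (0 <_) (sym (*-suc 2 y)) z<s) 2y+1<0)

  exps-positive : ∀ {Q} → 0 < length (exps b Q) → 1 ≤ Q
  exps-positive {zero}  0<ℓ = ⊥-elim (<-irrefl (sym (cong length exps-zero)) 0<ℓ)
  exps-positive {suc Q} _   = s≤s z≤n

  -- A term b^{r - 2t} of geom r y can only be skipped by an exponent e with e + 2t + 1 ≤ r.
  block : ∀ lam {r y Q} → 2 * y < r → Q < geom r y → lam < length (exps b Q) →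
    fromTop (exps b Q) lam + 2 * lam + 1 ≤ r → (∀ t → t < lam → ¬ (fromTop (exps b Q) t + 2 * t + 1 ≤ r)) →
    Block (geom r y) Q (fromTop (exps b Q) lam)
  block lam {r} {y} {Q} 2y<r Q<G lam<ℓ fits earlier with exps-top {Q} (exps-positive (≤-<-trans z≤n lam<ℓ))
  block zero {r} {y} {Q} 2y<r Q<G lam<ℓ fits earlier | p , d , Q′ , 1≤d , d<b , Q′<bᵖ , Q≡ , exps≡ =
    subst (Block (geom r y) Q) (sym top≡p)
      (0 , Q , subst (_< b ^ suc p) (sym Q≡) (lead-+-< p d<b Q′<bᵖ) , refl , ≤-trans (^-monoʳ-≤ b p<r) (b^r≤geom r y))
    where
    top≡p : fromTop (exps b Q) 0 ≡ p
    top≡p = trans (cong (λ xs → fromTop xs 0) exps≡) (fromTop-snoc-zero (exps b Q′) p)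
    p<r : p < r
    p<r = subst (_≤ r) (trans (cong (λ e → e + 2 * 0 + 1) top≡p) (x+2*0+1≡1+x p)) fits
  block (suc lam) {r} {y} 2y<r Q<G lam<ℓ fits earlier | p , d , Q′ , 1≤d , d<b , Q′<bᵖ , refl , exps≡
    with geom-leading {r} {y} 2y<r Q<G 1≤d (r<p+1 (earlier 0 z<s))
    where
    r<p+1 : ¬ (fromTop (exps b (d * b ^ p + Q′)) 0 + 2 * 0 + 1 ≤ r) → r < suc p
    r<p+1 ¬fits = subst (r <_) (trans (cong (λ e → e + 2 * 0 + 1) (trans (cong (λ xs → fromTop xs 0) exps≡)
      (fromTop-snoc-zero (exps b Q′) p))) (x+2*0+1≡1+x p)) (≰⇒> ¬fits)
  ... | refl , refl , y′ , refl with 2*[1+y]<r⇒r≡2+ y′ 2y<r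
  ... | r₂ , refl = subst (Block (geom r y) (1 * b ^ r + Q′)) (sym (top-suc lam lam<ℓ′))
    (Block-cons E+2≤r (block lam {r₂} {y′} 2y′<r₂ Q′<G lam<ℓ′ fits′ earlier′))
    where
    lam<ℓ′ : lam < length (exps b Q′)
    lam<ℓ′ = ≤-pred (subst (suc lam <_) (trans (cong length exps≡) (length-snoc (exps b Q′) r)) lam<ℓ)
    top-suc : ∀ t → t < length (exps b Q′) → fromTop (exps b (1 * b ^ r + Q′)) (suc t) ≡ fromTop (exps b Q′) t
    top-suc t t<ℓ = trans (cong (λ xs → fromTop xs (suc t)) exps≡) (fromTop-snoc-suc (exps b Q′) r t<ℓ)
    shift : ∀ t → t < length (exps b Q′) →
      fromTop (exps b (1 * b ^ r + Q′)) (suc t) + 2 * suc t + 1 ≡ suc (suc (fromTop (exps b Q′) t + 2 * t + 1))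
    shift t t<ℓ = trans (cong (λ e → e + 2 * suc t + 1) (top-suc t t<ℓ)) (ring (fromTop (exps b Q′) t) t)
      where
      ring : ∀ x t → x + 2 * suc t + 1 ≡ suc (suc (x + 2 * t + 1))
      ring = solve-∀
    fits′ : fromTop (exps b Q′) lam + 2 * lam + 1 ≤ r₂
    fits′ = ≤-pred (≤-pred (subst (_≤ r) (shift lam lam<ℓ′) fits))
    earlier′ : ∀ t → t < lam → ¬ (fromTop (exps b Q′) t + 2 * t + 1 ≤ r₂)
    earlier′ t t<lam le = earlier (suc t) (s<s t<lam) (subst (_≤ r) (sym (shift t (<-trans t<lam lam<ℓ′))) (s≤s (s≤s le)))
    E+2≤r : suc (suc (fromTop (exps b Q′) lam)) ≤ r
    E+2≤r = s≤s (s≤s (≤-trans (≤-trans (m≤m+n _ (2 * lam)) (m≤m+n _ 1)) fits′))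
    2y′<r₂ : 2 * y′ < r₂
    2y′<r₂ = ≤-pred (≤-pred (subst (_< r) (*-suc 2 y′) 2y<r))
    Q′<G : Q′ < geom r₂ y′
    Q′<G = +-cancelˡ-< (b ^ r) Q′ (geom r₂ y′) (subst (_< b ^ r + geom r₂ y′) (cong (_+ Q′) (*-identityˡ (b ^ r))) Q<G)

  maxS : List ℕ → ℕ
  maxS = foldr (λ n m → s b n ⊔ m) 0

  maxS-upper : ∀ n f {j} → j < n → s b (f j) ≤ maxS (applyUpTo f n)
  maxS-upper (suc n) f {zero}  _         = m≤m⊔n (s b (f 0)) _
  maxS-upper (suc n) f {suc j} (s<s j<n) = ≤-trans (maxS-upper n (f ∘ suc) j<n) (m≤n⊔m (s b (f 0)) _)

  maxS-attained : ∀ n f → 0 < n → ∃[ j ] (j < n × s b (f j) ≡ maxS (applyUpTo f n))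
  maxS-attained (suc zero) f _ = 0 , z<s , sym (⊔-identityʳ (s b (f 0)))
  maxS-attained (suc (suc n)) f _ with maxS-attained (suc n) (f ∘ suc) z<s
  ... | j , j<n , e with ≤-total (s b (f 0)) (maxS (applyUpTo (f ∘ suc) (suc n)))
  ...   | inj₁ le = suc j , s<s j<n , trans e (sym (m≤n⇒m⊔n≡n le))
  ...   | inj₂ ge = 0 , z<s , sym (m≥n⇒m⊔n≡m ge)

  firstWith-spec : ∀ n f m → ∃[ j ] (j < n × s b (f j) ≡ m) →
    ∃[ j ] (j < n × firstWith b m (applyUpTo f n) ≡ f j × s b (f j) ≡ m × (∀ i → i < j → s b (f i) ≢ m))
  firstWith-spec (suc n) f m (j₀ , j₀<n , e₀) with s b (f 0) ≡ᵇ m in eq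
  ... | true = 0 , z<s , refl , ≡ᵇ⇒≡ _ _ (subst T (sym eq) _) , (λ i ())
  ... | false with j₀
  ...   | zero   = ⊥-elim (subst T eq (≡⇒≡ᵇ _ _ e₀))
  ...   | suc j₁ with firstWith-spec n (f ∘ suc) m (j₁ , ≤-pred j₀<n , e₀)
  ...     | j , j<n , found , hit , misses = suc j , s<s j<n , found , hit , misses′
    where
    misses′ : ∀ i → i < suc j → s b (f i) ≢ m
    misses′ zero    _         e = subst T eq (≡⇒≡ᵇ _ _ e)
    misses′ (suc i) (s<s i<j) = misses i i<j

  ν-spec : ∀ k r y → 0 < geomSum b r y →
    ∃[ j ] (j < geomSum b r y × ν b k r y ≡ b ^ k + suc j ×
            (∀ j′ → j′ < geomSum b r y → s b (b ^ k + suc j′) ≤ s b (b ^ k + suc j)) ×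
            (∀ j′ → j′ < j → s b (b ^ k + suc j′) < s b (b ^ k + suc j)))
  ν-spec k r y 0<G with maxS-attained (geomSum b r y) (λ j → b ^ k + suc j) 0<G
  ... | j₀ , j₀<G , e₀ with firstWith-spec (geomSum b r y) (λ j → b ^ k + suc j) (μ b k r y)
                             (j₀ , j₀<G , trans e₀ (cong maxS (sym (map-upTo (λ j → b ^ k + suc j) (geomSum b r y)))))
  ...   | j , j<G , found , hit , misses =
    j , j<G , trans (cong (firstWith b (μ b k r y)) interval≡) found ,
    (λ j′ j′<G → subst (s b (f j′) ≤_) (sym hit) (below-μ j′<G)) ,
    (λ j′ j′<j → ≤∧≢⇒< (subst (s b (f j′) ≤_) (sym hit) (below-μ (<-trans j′<j j<G)))
                       (λ e → misses j′ j′<j (trans e hit)))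
    where
    G = geomSum b r y
    f = λ j → b ^ k + suc j
    interval≡ : intervalList b k r y ≡ applyUpTo f G
    interval≡ = map-upTo f G
    below-μ : ∀ {j′} → j′ < G → s b (f j′) ≤ μ b k r y
    below-μ j′<G = subst (λ xs → s b (f _) ≤ maxS xs) (sym interval≡) (maxS-upper G f j′<G)

  s-suffix : ∀ n m P R → R < b ^ m → P * b ^ m + R < b ^ (n + m) → s b (suc (P * b ^ m + R)) ≡ score (run (1 , 0) n P) m R
  s-suffix n m P R R<bᵐ N<bⁿ⁺ᵐ =
    trans (sym (cong proj₁ (run-s (n + m) (P * b ^ m + R) N<bⁿ⁺ᵐ))) (cong proj₁ (run-++ m (1 , 0) n P R R<bᵐ))

  Alternating-high : ∀ n P {R} → Alternating n R → Alternating n (P * b ^ n + R)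
  Alternating-high n P {R} alt 1≤i i+1<n e =
    alt 1≤i i+1<n (trans (sym (digit-low P R (<-trans (n<1+n _) i+1<n))) (trans e (digit-low P R i+1<n)))

  -- Inside the block, the values s(b^k + 1 + j′) are scores of one run of the automaton; the block's
  -- digit 0 at position E + 1 puts it in a state (x, y) with y < x.
  block-alternating : ∀ {k G j E} → G ≤ b ^ k → suc (suc E) ≤ k →
    (∀ j′ → j′ < G → s b (b ^ k + suc j′) ≤ s b (b ^ k + suc j)) →
    (∀ j′ → j′ < j → s b (b ^ k + suc j′) < s b (b ^ k + suc j)) →
    Block G j E → Alternating (suc (suc E)) (b ^ k + j)
  block-alternating {k} {G} {E = E} G≤bᵏ E+2≤k max first (A , R , R<X , refl , in-G) =
    subst (Alternating (suc (suc E))) (sym (N≡ R)) (Alternating-high (suc (suc E)) P (FirstMax-alternating-lead-1 E y<x fm))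
    where
    K = k ∸ suc (suc E)
    X₂ = b ^ suc (suc E)
    P = b ^ K + A
    w = run (1 , 0) (suc K) P
    y<x : proj₂ w < proj₁ w + proj₂ w
    y<x = m<n+m (proj₂ w) (run-positive (suc K) (1 , 0) P (s≤s z≤n))
    ring : ∀ B X A R → B * X + (A * X + R) ≡ (B + A) * X + (0 * b ^ suc E + R)
    ring = solve-∀
    N≡ : ∀ R′ → b ^ k + (A * X₂ + R′) ≡ P * X₂ + (0 * b ^ suc E + R′)
    N≡ R′ = trans (cong (_+ (A * X₂ + R′)) (trans (cong (b ^_) (sym (m∸n+n≡m E+2≤k))) (^-distribˡ-+-* b K (suc (suc E)))))
                  (ring (b ^ K) X₂ A R′)
    in-block : ∀ {R′} → R′ < b ^ suc E → A * X₂ + R′ < G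
    in-block R′<X = <-≤-trans (+-monoʳ-< (A * X₂) R′<X) in-G
    score≡ : ∀ R′ → R′ < b ^ suc E → s b (b ^ k + suc (A * X₂ + R′)) ≡ score (step w 0) (suc E) R′
    score≡ R′ R′<X = begin
      s b (b ^ k + suc (A * X₂ + R′))             ≡⟨ cong (s b) (trans (+-suc (b ^ k) _) (cong suc (N≡ R′))) ⟩
      s b (suc (P * X₂ + (0 * b ^ suc E + R′)))    ≡⟨ s-suffix (suc K) (suc (suc E)) P _ (lead-+-< (suc E) z<s R′<X) N< ⟩
      score w (suc (suc E)) (0 * b ^ suc E + R′)  ≡⟨ score-lead (suc E) w z<s R′<X ⟩
      score (step w 0) (suc E) R′                 ∎
      where
      open ≡-Reasoning
      N< : P * X₂ + (0 * b ^ suc E + R′) < b ^ (suc K + suc (suc E))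
      N< = subst₂ _<_ (N≡ R′) (cong (b ^_) (sym (cong suc (m∸n+n≡m E+2≤k))))
             (<-≤-trans (+-monoʳ-< (b ^ k) (in-block R′<X)) (≤-trans (+-monoʳ-≤ (b ^ k) G≤bᵏ) (x+x≤b*x (b ^ k))))
    fm : FirstMax (step w 0) (suc E) R
    fm = R<X ,
      (λ R′ R′<X → subst₂ _≤_ (score≡ R′ R′<X) (score≡ R R<X) (max (A * X₂ + R′) (in-block R′<X))) ,
      (λ R′ R′<R → subst₂ _<_ (score≡ R′ (<-trans R′<R R<X)) (score≡ R R<X)
                     (first (A * X₂ + R′) (+-monoʳ-< (A * X₂) R′<R)))

  ν∸1-spec : ∀ k r y → 2 * y < r → r + 1 < k →
    ∃[ j ] (ν b k r y ∸ 1 ≡ b ^ k + j × exps b (b ^ k + j) ≡ exps b j ++ k ∷ [] × j < geom r y ×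
            (∀ j′ → j′ < geom r y → s b (b ^ k + suc j′) ≤ s b (b ^ k + suc j)) ×
            (∀ j′ → j′ < j → s b (b ^ k + suc j′) < s b (b ^ k + suc j)))
  ν∸1-spec k r y 2y<r r+1<k with ν-spec k r y (subst (0 <_) (sym (geomSum≡geom r y)) (≤-trans (m^n>0 b r) (b^r≤geom r y)))
  ... | j , j<G , ν≡ , max , first =
    j , cong (_∸ 1) (trans ν≡ (+-suc (b ^ k) j)) , subst (λ z → exps b (z + j) ≡ exps b j ++ k ∷ []) (*-identityˡ (b ^ k))
      (exps-lead k (s≤s z≤n) (s<s z<s) (<-≤-trans j<G′ (geom≤b^k {r} {y} 2y<r r<k))) , j<G′ ,
    (λ j′ j′<G → max j′ (subst (j′ <_) (sym (geomSum≡geom r y)) j′<G)) , first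
    where
    j<G′ = subst (j <_) (geomSum≡geom r y) j<G
    r<k = <-trans (m<m+n r z<s) r+1<k

lemma17 : (b k r y : ℕ) → 2 ≤ b → 2 * y < r → r + 1 < k →
    (lam : ℕ) →
    lam < length (exps b (ν b k r y ∸ 1)) ∸ 1 →
    nth (exps b (ν b k r y ∸ 1)) (length (exps b (ν b k r y ∸ 1)) ∸ 1 ∸ 1 ∸ lam) + 2 * lam + 1 ≤ r →
    ((t : ℕ) → t < lam →
      ¬ (nth (exps b (ν b k r y ∸ 1)) (length (exps b (ν b k r y ∸ 1)) ∸ 1 ∸ 1 ∸ t) + 2 * t + 1 ≤ r)) →
    ¬ (∃[ i ] (1 ≤ i × i ≤ nth (exps b (ν b k r y ∸ 1)) (length (exps b (ν b k r y ∸ 1)) ∸ 1 ∸ 1 ∸ lam)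
              × digit b (ν b k r y ∸ 1) i ≡ digit b (ν b k r y ∸ 1) (suc i)))
lemma17 (suc zero) _ _ _ (s≤s ())
lemma17 (suc (suc c)) k r y _ 2y<r r+1<k lam with Radix.ν∸1-spec c k r y 2y<r r+1<k
... | j , N≡ , exps≡ , j<G , max , first rewrite N≡ | exps≡ = λ lam<ℓ fits earlier (i , 1≤i , i≤E , same) →
  let lam<ℓ′ = subst (lam <_) (cong (_∸ 1) (length-snoc (exps b j) k)) lam<ℓ
      top≡ = λ {t} → fromTop-below-last (exps b j) k {t}
      fits′ = subst (λ e → e + 2 * lam + 1 ≤ r) (top≡ lam<ℓ′) fits
      earlier′ = λ t t<lam → earlier t t<lam ∘ subst (λ e → e + 2 * t + 1 ≤ r) (sym (top≡ (<-trans t<lam lam<ℓ′)))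
      E = fromTop (exps b j) lam
      E+1≤r = ≤-trans (≤-trans (≤-reflexive (+-comm 1 E)) (+-monoˡ-≤ 1 (m≤m+n E (2 * lam)))) fits′
      E+2≤k = ≤-trans (s≤s E+1≤r) (≤-trans (≤-reflexive (+-comm 1 r)) (<⇒≤ r+1<k))
      alternating = block-alternating (geom≤b^k {r} {y} 2y<r (<-trans (m<m+n r z<s) r+1<k)) E+2≤k max first
                      (block lam {r} {y} 2y<r j<G lam<ℓ′ fits′ earlier′)
  in alternating 1≤i (s≤s (s≤s (subst (i ≤_) (top≡ lam<ℓ′) i≤E))) same
  where open Radix c
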